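{- Let $\mathcal{M}^c=\langle S^c,N^c,V^c\rangle$ be the canonical model for $\mathbf{R}^\Delta$. Then $\mathcal{M}^c$ possesses property $(i)$: for every $s\in S^c$, $X,Y\in N^c(s)$ implies $X\cap Y\in N^c(s)$. Consequently its supplementation $(\mathcal{M}^c)^+$ also possesses property $(i)$.
   Context: $\mathcal{L}(\Delta)$: $\phi::=p\mid\neg\phi\mid\phi\land\phi\mid\Delta\phi$, $p$ in a countable set $\mathbf{P}$. $\mathbf{R}^\Delta$ is axiomatized by all propositional tautologies, $\Delta\phi\leftrightarrow\Delta\neg\phi$, $\Delta\phi\to\Delta(\phi\vee\psi)\vee\Delta(\neg\phi\vee\chi)$, $\Delta\phi\land\Delta\psi\to\Delta(\phi\land\psi)$, modus ponens, and RE$\Delta$ (from $\phi\leftrightarrow\psi$ infer $\Delta\phi\leftrightarrow\Delta\psi$). Canonical model: $S^c$ = maximal $\mathbf{R}^\Delta$-consistent sets; $|\phi|=\{s\in S^c\mid\phi\in s\}$; $N^c(s)=\{|\phi|\mid\Delta(\phi\vee\psi)\in s\text{ for every formula }\psi\}$; $V^c(p)=|p|$. Supplementation: $(N^c)^+(s)=\{X\subseteq S^c\mid Y\subseteq X\text{ for some }Y\in N^c(s)\}$. -}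

module Defs where

open import Data.Nat using (ℕ)
open import Data.Bool using (Bool; true; false; not; _∧_)
open import Data.List using (List; []; _∷_)
open import Data.List.Relation.Unary.All using (All)
open import Data.Product using (Σ; _×_; _,_)
open import Data.Sum using (_⊎_)
open import Relation.Binary.PropositionalEquality using (_≡_)
open import Relation.Nullary using (¬_)
open import Level using (Level; _⊔_) renaming (suc to lsuc; zero to lzero)

data Form : Set where
  var  : ℕ → Form
  neg  : Form → Form
  _and_ : Form → Form → Form
  Δ    : Form → Form

infixr 6 _and_
infixr 5 _or_
infixr 4 _imp_ _iff_

_or_ : Form → Form → Form
φ or ψ = neg (neg φ and neg ψ)

_imp_ : Form → Form → Form
φ imp ψ = neg (φ and neg ψ)

_iff_ : Form → Form → Form
φ iff ψ = (φ imp ψ) and (ψ imp φ)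

⊤F : Form
⊤F = neg (var 0 and neg (var 0))

-- This is exactly the set of substitution instances of tautologies.

eval : (ℕ → Bool) → (Form → Bool) → Form → Bool
eval va vd (var p)   = va p
eval va vd (neg φ)   = not (eval va vd φ)
eval va vd (φ and ψ) = eval va vd φ ∧ eval va vd ψ
eval va vd (Δ φ)     = vd φ

Tautology : Form → Set
Tautology φ = (va : ℕ → Bool) (vd : Form → Bool) → eval va vd φ ≡ true

data ⊢_ : Form → Set where
  taut  : ∀ {φ} → Tautology φ → ⊢ φ
  axNeg : ∀ {φ} → ⊢ (Δ φ iff Δ (neg φ))
  axOr  : ∀ {φ ψ χ} → ⊢ (Δ φ imp (Δ (φ or ψ) or Δ (neg φ or χ)))
  axAnd : ∀ {φ ψ} → ⊢ ((Δ φ and Δ ψ) imp Δ (φ and ψ))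
  mp    : ∀ {φ ψ} → ⊢ (φ imp ψ) → ⊢ φ → ⊢ ψ
  reΔ   : ∀ {φ ψ} → ⊢ (φ iff ψ) → ⊢ (Δ φ iff Δ ψ)

FSet : Set₁
FSet = Form → Set

conj : List Form → Form
conj []       = ⊤F
conj (φ ∷ l)  = φ and conj l

Consistent : FSet → Set
Consistent Γ = (l : List Form) → All Γ l → ¬ (⊢ neg (conj l))

_⊆F_ : FSet → FSet → Set
Γ ⊆F Γ' = ∀ φ → Γ φ → Γ' φ

MaximalConsistent : FSet → Set₁
MaximalConsistent Γ = Consistent Γ × ((Γ' : FSet) → Consistent Γ' → Γ ⊆F Γ' → Γ' ⊆F Γ)

Sc : Set₁
Sc = Σ FSet MaximalConsistent

_∋_ : Sc → Form → Set
(Γ , _) ∋ φ = Γ φ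

Subset : Set₁
Subset = Sc → Set

_≐_ : Subset → Subset → Set₁
X ≐ Y = ∀ s → (X s → Y s) × (Y s → X s)

_⊆_ : Subset → Subset → Set₁
X ⊆ Y = ∀ s → X s → Y s

_∩_ : Subset → Subset → Subset
(X ∩ Y) s = X s × Y s

∣_∣ : Form → Subset
∣ φ ∣ s = s ∋ φ

Nc : Sc → Subset → Set₁
Nc s X = Σ Form λ φ → (X ≐ ∣ φ ∣) × ((ψ : Form) → s ∋ Δ (φ or ψ))

Vc : ℕ → Subset
Vc p = ∣ var p ∣

Nc⁺ : Sc → Subset → Set₁
Nc⁺ s X = Σ Subset λ Y → Nc s Y × (Y ⊆ X)

PropertyI : (Sc → Subset → Set₁) → Set₁
PropertyI N = (s : Sc) (X Y : Subset) → N s X → N s Y → N s (X ∩ Y)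

-- A maximal consistent set contains every theorem and is closed under modus
-- ponens, so |φ| ∩ |χ| = |φ ∧ χ|.  If Δ(φ ∨ ψ) and Δ(χ ∨ ψ) lie in s for every
-- ψ, then by Δφ ∧ Δψ → Δ(φ ∧ ψ) so does Δ((φ ∨ ψ) ∧ (χ ∨ ψ)), which by RE Δ and
-- distributivity is Δ((φ ∧ χ) ∨ ψ).  Supplementation preserves closure under
-- intersection for any neighbourhood function.
module Submission where

open import Defs
open import Data.Bool using (Bool; true; false; not; _∧_)
open import Data.Empty using (⊥-elim)
open import Data.List using (List; []; _∷_; _++_)
open import Data.List.Relation.Unary.All using (All; []; _∷_)
open import Data.List.Relation.Unary.All.Properties using (++⁺; ++⁻)
open import Data.Nat using (ℕ)
open import Data.Product using (_×_; _,_; proj₁; proj₂; Σ)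
open import Data.Sum using (_⊎_; inj₁; inj₂)
open import Function using (case_of_)
open import Relation.Binary.PropositionalEquality using (_≡_; refl; sym; trans; cong; cong₂)
open import Relation.Nullary using (¬_)

module Semantics (va : ℕ → Bool) (vd : Form → Bool) where

  -- A record, so that Agda can recover φ from Holds φ.
  record Holds (φ : Form) : Set where
    constructor holds
    field truth : eval va vd φ ≡ true

  neg-intro : ∀ {φ} → ¬ Holds φ → Holds (neg φ)
  neg-intro {φ} ¬hφ with eval va vd φ in eφ
  ... | true  = ⊥-elim (¬hφ (holds eφ))
  ... | false = holds (cong not eφ)

  neg-elim : ∀ {φ} → Holds (neg φ) → ¬ Holds φ
  neg-elim (holds hnφ) (holds hφ) with () ← trans (sym (cong not hφ)) hnφ

  double-neg-elim : ∀ {φ} → ¬ ¬ Holds φ → Holds φ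
  double-neg-elim {φ} ¬¬hφ with eval va vd φ in eφ
  ... | true  = holds eφ
  ... | false = ⊥-elim (¬¬hφ λ (holds hφ) → case trans (sym eφ) hφ of λ ())

  and-intro : ∀ {φ ψ} → Holds φ → Holds ψ → Holds (φ and ψ)
  and-intro (holds hφ) (holds hψ) = holds (cong₂ _∧_ hφ hψ)

  and-elim : ∀ {φ ψ} → Holds (φ and ψ) → Holds φ × Holds ψ
  and-elim {φ} {ψ} (holds h) with eval va vd φ in eφ | eval va vd ψ in eψ
  ... | true | true = holds eφ , holds eψ

  imp-intro : ∀ {φ ψ} → (Holds φ → Holds ψ) → Holds (φ imp ψ)
  imp-intro f = neg-intro λ h → let hφ , hnψ = and-elim h in neg-elim hnψ (f hφ)

  imp-elim : ∀ {φ ψ} → Holds (φ imp ψ) → Holds φ → Holds ψ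
  imp-elim h hφ = double-neg-elim λ ¬hψ → neg-elim h (and-intro hφ (neg-intro ¬hψ))

  contrapose : ∀ {φ ψ} → (Holds ψ → Holds φ) → Holds (neg φ imp neg ψ)
  contrapose f = imp-intro λ hnφ → neg-intro λ hψ → neg-elim hnφ (f hψ)

  ⊤F-holds : Holds ⊤F
  ⊤F-holds = neg-intro λ h → let hp , hnp = and-elim h in neg-elim hnp hp

  conj-intro : ∀ {l} → All Holds l → Holds (conj l)
  conj-intro []         = ⊤F-holds
  conj-intro (hφ ∷ hl)  = and-intro hφ (conj-intro hl)

  conj-elim : ∀ l → Holds (conj l) → All Holds l
  conj-elim []      _ = []
  conj-elim (φ ∷ l) h = let hφ , hl = and-elim h in hφ ∷ conj-elim l hl

∨-distribʳ-∧ : ∀ φ χ ψ → Tautology (((φ or ψ) and (χ or ψ)) iff ((φ and χ) or ψ))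
∨-distribʳ-∧ φ χ ψ va vd with eval va vd φ | eval va vd χ | eval va vd ψ
... | true  | true  | true  = refl
... | true  | true  | false = refl
... | true  | false | true  = refl
... | true  | false | false = refl
... | false | true  | true  = refl
... | false | true  | false = refl
... | false | false | true  = refl
... | false | false | false = refl

⊢-valid : ∀ {φ} → (∀ va vd → Semantics.Holds va vd φ) → ⊢ φ
⊢-valid h = taut λ va vd → Semantics.Holds.truth (h va vd)

⊢φ⇒ψ⇒φ : ∀ {φ ψ} → ⊢ (φ imp (ψ imp φ))
⊢φ⇒ψ⇒φ = ⊢-valid λ va vd → let open Semantics va vd in imp-intro λ hφ → imp-intro λ _ → hφ

⊢φ⇒ψ⇒φ∧ψ : ∀ {φ ψ} → ⊢ (φ imp (ψ imp (φ and ψ)))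
⊢φ⇒ψ⇒φ∧ψ = ⊢-valid λ va vd → let open Semantics va vd in
  imp-intro λ hφ → imp-intro λ hψ → and-intro hφ hψ

⊢φ∧ψ⇒φ : ∀ {φ ψ} → ⊢ ((φ and ψ) imp φ)
⊢φ∧ψ⇒φ = ⊢-valid λ va vd → let open Semantics va vd in imp-intro λ h → proj₁ (and-elim h)

⊢φ∧ψ⇒ψ : ∀ {φ ψ} → ⊢ ((φ and ψ) imp ψ)
⊢φ∧ψ⇒ψ = ⊢-valid λ va vd → let open Semantics va vd in imp-intro λ h → proj₂ (and-elim h)

⊢modus-ponens : ∀ {φ ψ} → ⊢ (conj ((φ imp ψ) ∷ φ ∷ []) imp ψ)
⊢modus-ponens = ⊢-valid λ va vd → let open Semantics va vd in
  imp-intro λ h → case conj-elim (_ ∷ _ ∷ []) h of λ where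
    (hφ⇒ψ ∷ hφ ∷ []) → imp-elim hφ⇒ψ hφ

module MaximalConsistentProperties {Γ : FSet} (mc : MaximalConsistent Γ) where

  private
    extend : Form → FSet
    extend ρ φ = Γ φ ⊎ φ ≡ ρ

    old : ∀ {ρ} (m : List Form) → All (extend ρ) m → List Form
    old []      []            = []
    old (φ ∷ m) (inj₁ _ ∷ a)  = φ ∷ old m a
    old (φ ∷ m) (inj₂ _ ∷ a)  = old m a

    old-⊆ : ∀ {ρ} (m : List Form) (a : All (extend ρ) m) → All Γ (old m a)
    old-⊆ []      []            = []
    old-⊆ (φ ∷ m) (inj₁ γ ∷ a)  = γ ∷ old-⊆ m a
    old-⊆ (φ ∷ m) (inj₂ _ ∷ a)  = old-⊆ m a

    module _ (va : ℕ → Bool) (vd : Form → Bool) where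
      open Semantics va vd

      restore : ∀ {ρ} (m : List Form) (a : All (extend ρ) m) →
                Holds ρ → All Holds (old m a) → All Holds m
      restore []      []               hρ _         = []
      restore (φ ∷ m) (inj₁ _ ∷ a)    hρ (hφ ∷ h) = hφ ∷ restore m a hρ h
      restore (φ ∷ m) (inj₂ refl ∷ a) hρ h         = hρ ∷ restore m a hρ h

  -- A refutation of m ⊆ Γ ∪ {ρ} becomes one of l ++ old m ⊆ Γ: ρ is implied by l.
  ∈-closed-under-⊢ : ∀ {ρ} (l : List Form) → All Γ l → ⊢ (conj l imp ρ) → Γ ρ
  ∈-closed-under-⊢ {ρ} l l⊆Γ ⊢l⇒ρ = proj₂ mc (extend ρ) consistent (λ _ → inj₁) ρ (inj₂ refl)
    where
      replace : ∀ m (a : All (extend ρ) m) →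
                ⊢ ((conj l imp ρ) imp (neg (conj m) imp neg (conj (l ++ old m a))))
      replace m a = ⊢-valid λ va vd → let open Semantics va vd in
        imp-intro λ hl⇒ρ → contrapose λ h →
          let hl , hold = ++⁻ l (conj-elim (l ++ old m a) h)
          in conj-intro (restore va vd m a (imp-elim hl⇒ρ (conj-intro hl)) hold)

      consistent : Consistent (extend ρ)
      consistent m a ⊢¬m =
        proj₁ mc (l ++ old m a) (++⁺ l⊆Γ (old-⊆ m a)) (mp (mp (replace m a) ⊢l⇒ρ) ⊢¬m)

  ⊢⇒∈ : ∀ {φ} → ⊢ φ → Γ φ
  ⊢⇒∈ ⊢φ = ∈-closed-under-⊢ [] [] (mp ⊢φ⇒ψ⇒φ ⊢φ)

  ∈-mp : ∀ {φ ψ} → Γ (φ imp ψ) → Γ φ → Γ ψ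
  ∈-mp φ⇒ψ∈Γ φ∈Γ = ∈-closed-under-⊢ _ (φ⇒ψ∈Γ ∷ φ∈Γ ∷ []) ⊢modus-ponens

  ∈-and⁺ : ∀ {φ ψ} → Γ φ → Γ ψ → Γ (φ and ψ)
  ∈-and⁺ φ∈Γ ψ∈Γ = ∈-mp (∈-mp (⊢⇒∈ ⊢φ⇒ψ⇒φ∧ψ) φ∈Γ) ψ∈Γ

  ∈-and⁻ : ∀ {φ ψ} → Γ (φ and ψ) → Γ φ × Γ ψ
  ∈-and⁻ φψ∈Γ = ∈-mp (⊢⇒∈ ⊢φ∧ψ⇒φ) φψ∈Γ , ∈-mp (⊢⇒∈ ⊢φ∧ψ⇒ψ) φψ∈Γ

∣and∣ : ∀ φ χ → (∣ φ ∣ ∩ ∣ χ ∣) ≐ ∣ φ and χ ∣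
∣and∣ φ χ (Γ , mc) = (λ (φ∈Γ , χ∈Γ) → ∈-and⁺ φ∈Γ χ∈Γ) , ∈-and⁻
  where open MaximalConsistentProperties mc

∩-cong-≐ : ∀ {X X′ Y Y′} → X ≐ X′ → Y ≐ Y′ → (X ∩ Y) ≐ (X′ ∩ Y′)
∩-cong-≐ X≐X′ Y≐Y′ s =
    (λ (x , y) → proj₁ (X≐X′ s) x , proj₁ (Y≐Y′ s) y)
  , (λ (x , y) → proj₂ (X≐X′ s) x , proj₂ (Y≐Y′ s) y)

≐-trans : ∀ {X Y Z} → X ≐ Y → Y ≐ Z → X ≐ Z
≐-trans X≐Y Y≐Z s = (λ x → proj₁ (Y≐Z s) (proj₁ (X≐Y s) x)) , (λ z → proj₂ (X≐Y s) (proj₂ (Y≐Z s) z))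

Δ-∨-and : ∀ (s : Sc) {φ χ} ψ → s ∋ Δ (φ or ψ) → s ∋ Δ (χ or ψ) → s ∋ Δ ((φ and χ) or ψ)
Δ-∨-and (Γ , mc) {φ} {χ} ψ Δφψ Δχψ =
  ∈-mp (proj₁ (∈-and⁻ (⊢⇒∈ (reΔ (taut (∨-distribʳ-∧ φ χ ψ))))))
       (∈-mp (⊢⇒∈ axAnd) (∈-and⁺ Δφψ Δχψ))
  where open MaximalConsistentProperties mc

Nc-∩ : PropertyI Nc
Nc-∩ s X Y (φ , X≐φ , Δφ) (χ , Y≐χ , Δχ) =
  (φ and χ) , ≐-trans (∩-cong-≐ X≐φ Y≐χ) (∣and∣ φ χ) , λ ψ → Δ-∨-and s ψ (Δφ ψ) (Δχ ψ)

Supplementation : (Sc → Subset → Set₁) → Sc → Subset → Set₁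
Supplementation N s X = Σ Subset λ Y → N s Y × (Y ⊆ X)

Supplementation-∩ : ∀ {N} → PropertyI N → PropertyI (Supplementation N)
Supplementation-∩ N-∩ s X Y (X′ , X′∈N , X′⊆X) (Y′ , Y′∈N , Y′⊆Y) =
  X′ ∩ Y′ , N-∩ s X′ Y′ X′∈N Y′∈N , λ t (x , y) → X′⊆X t x , Y′⊆Y t y

mainTheorem14 : PropertyI Nc × PropertyI Nc⁺
mainTheorem14 = Nc-∩ , Supplementation-∩ Nc-∩
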